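{- There exists a $(\mathbb Z_2^3\times\mathbb Z_3^2,\{2^7,3^2\},3,1)$-difference family.
   Context: Let $(G,+)$ be a finite abelian group. A partial spread of $G$ is a family $\Sigma$ of subgroups of $G$ whose members pairwise intersect trivially; it has type $\{n_1^{f_1},\dots,n_t^{f_t}\}$ if it consists of exactly $f_i$ subgroups of order $n_i$ for each $i$ (and no others). For a triple $T=\{a,b,c\}$ of three distinct elements of $G$, $\Delta T$ is the multiset $\{\pm(a-b),\pm(a-c),\pm(b-c)\}$, and for a set $\mathcal T$ of triples, $\Delta\mathcal T$ is the multiset union of the $\Delta T$. For a partial spread $\Sigma$, a $(G,\Sigma,3,1)$-difference family is a set $\mathcal T$ of triples of $G$ with $\Delta\mathcal T=G\setminus\bigcup_{S\in\Sigma}S$ as multisets (each element outside the union occurs exactly once, elements of the union do not occur). A $(G,\tau,3,1)$-difference family is a $(G,\Sigma,3,1)$-difference family for some partial spread $\Sigma$ of $G$ of type $\tau$. -}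

module Defs where

open import Data.Nat using (ℕ; zero; suc; _+_; _∸_; NonZero)
open import Data.Nat.DivMod using (_mod_)
open import Data.Fin using (Fin; toℕ)
open import Data.Fin.Properties using () renaming (_≟_ to _≟F_)
open import Data.Bool using (Bool; true; false; _∨_)
open import Data.List using (List; []; _∷_; length; filter; concatMap; map; allFin; cartesianProduct; foldr)
open import Data.Bool.ListAction using (any)
open import Data.List.Relation.Unary.All using (All)
open import Data.List.Relation.Unary.Any using (Any)
open import Data.List.Relation.Unary.AllPairs using (AllPairs)
open import Data.List.Membership.Propositional using (_∈_)
open import Data.Product using (_×_; _,_; Σ; ∃)
open import Data.Product.Properties using (≡-dec)
open import Data.Sum using (_⊎_)
open import Relation.Binary.PropositionalEquality using (_≡_; _≢_)
open import Relation.Nullary using (Dec; yes; no)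
open import Relation.Nullary.Decidable using (⌊_⌋)

_+ₙ_ : {n : ℕ} .{{_ : NonZero n}} → Fin n → Fin n → Fin n
_+ₙ_ {n} a b = (toℕ a + toℕ b) mod n

negₙ : {n : ℕ} .{{_ : NonZero n}} → Fin n → Fin n
negₙ {n} a = (n ∸ toℕ a) mod n

G : Set
G = Fin 2 × Fin 2 × Fin 2 × Fin 3 × Fin 3

0G : G
0G = (Data.Fin.zero , Data.Fin.zero , Data.Fin.zero , Data.Fin.zero , Data.Fin.zero)

_+G_ : G → G → G
(a₁ , a₂ , a₃ , a₄ , a₅) +G (b₁ , b₂ , b₃ , b₄ , b₅) =
  (a₁ +ₙ b₁ , a₂ +ₙ b₂ , a₃ +ₙ b₃ , a₄ +ₙ b₄ , a₅ +ₙ b₅)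

-G_ : G → G
-G (a₁ , a₂ , a₃ , a₄ , a₅) = (negₙ a₁ , negₙ a₂ , negₙ a₃ , negₙ a₄ , negₙ a₅)

_-G_ : G → G → G
a -G b = a +G (-G b)

_≟G_ : (x y : G) → Dec (x ≡ y)
_≟G_ = ≡-dec _≟F_ (≡-dec _≟F_ (≡-dec _≟F_ (≡-dec _≟F_ _≟F_)))

allG : List G
allG = cartesianProduct (allFin 2)
        (cartesianProduct (allFin 2)
          (cartesianProduct (allFin 2)
            (cartesianProduct (allFin 3) (allFin 3))))

record Subgroup : Set where
  field
    mem     : G → Bool
    has-0   : mem 0G ≡ true
    +-closed : ∀ x y → mem x ≡ true → mem y ≡ true → mem (x +G y) ≡ true
open Subgroup public

order : Subgroup → ℕ
order S = length (filter (λ g → mem S g Data.Bool.≟ true) allG)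

TrivialIntersection : Subgroup → Subgroup → Set
TrivialIntersection S S' = ∀ g → mem S g ≡ true → mem S' g ≡ true → g ≡ 0G

PartialSpread : List Subgroup → Set
PartialSpread Σs = AllPairs TrivialIntersection Σs

-- type {n₁^f₁,…,n_t^f_t}: given as a list of pairs (nᵢ , fᵢ) with distinct nᵢ;
-- every member has order some nᵢ, and exactly fᵢ members have order nᵢ.
countOrder : ℕ → List Subgroup → ℕ
countOrder n Σs = length (filter (λ S → order S Data.Nat.≟ n) Σs)

HasType : List Subgroup → List (ℕ × ℕ) → Set
HasType Σs τ =
  All (λ S → Any (λ p → order S ≡ Data.Product.proj₁ p) τ) Σs
  × All (λ p → countOrder (Data.Product.proj₁ p) Σs ≡ Data.Product.proj₂ p) τ

record Triple : Set where
  constructor triple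
  field
    a b c : G
    a≢b : a ≢ b
    a≢c : a ≢ c
    b≢c : b ≢ c
open Triple public

ΔT : Triple → List G
ΔT T = (a T -G b T) ∷ (b T -G a T) ∷ (a T -G c T) ∷ (c T -G a T)
       ∷ (b T -G c T) ∷ (c T -G b T) ∷ []

Δ𝒯 : List Triple → List G
Δ𝒯 𝒯 = concatMap ΔT 𝒯

count : G → List G → ℕ
count g xs = length (filter (λ x → x ≟G g) xs)

inUnion : List Subgroup → G → Bool
inUnion Σs g = any (λ S → mem S g) Σs

outside : List Subgroup → G → ℕ
outside Σs g with inUnion Σs g
... | true  = 0
... | false = 1

-- (G,Σ,3,1)-difference family: Δ𝒯 = G ∖ ⋃Σ as multisets
-- (𝒯 is a set of triples; a list with a repeated triple would violate the
--  multiplicity condition, so lists are harmless here)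
IsDifferenceFamily : List Subgroup → List Triple → Set
IsDifferenceFamily Σs 𝒯 = ∀ g → count g (Δ𝒯 𝒯) ≡ outside Σs g

HasDifferenceFamilyOfType : List (ℕ × ℕ) → Set
HasDifferenceFamilyOfType τ =
  Σ (List Subgroup) λ Σs → PartialSpread Σs × HasType Σs τ
    × Σ (List Triple) λ 𝒯 → IsDifferenceFamily Σs 𝒯

{-# OPTIONS --safe #-}
-- Take as spread the seven subgroups of order 2 of Z₂³ × 0 and the two coordinate subgroups
-- 0 × Z₃ × 0 and 0 × 0 × Z₃.  Their union has 1 + 7 + 4 = 12 elements, leaving 60 = 10 · 6
-- elements to be covered, so ten triples are needed; ten base triples {0, b, c} do the job.
-- Every notion in the statement is decidable on the 72-element group G, so both properties
-- are certified by evaluation.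
module Submission where

open import Defs
open import Data.Bool using (true) renaming (_≟_ to _≟ᵇ_)
open import Data.Fin using (#_)
open import Data.Fin.Properties using (all?)
open import Data.List using (List; []; _∷_; iterate; map)
open import Data.List.Membership.DecPropositional _≟G_ using (_∈_; _∈?_)
open import Data.List.Relation.Unary.All as All using (All)
open import Data.List.Relation.Unary.AllPairs using (allPairs?)
open import Data.List.Relation.Unary.Any using (here; any?)
open import Data.Nat using () renaming (_≟_ to _≟ℕ_)
open import Data.Product using (_,_; proj₁; proj₂)
open import Relation.Binary.PropositionalEquality using (_≡_; refl)
open import Relation.Nullary using (Dec; yes; does; _×-dec_; _→-dec_)
open import Relation.Nullary.Decidable using (map′; dec-true; from-yes)
open import Relation.Unary using (Decidable)

does≡true⇒ : ∀ {a} {A : Set a} (a? : Dec A) → does a? ≡ true → A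
does≡true⇒ (yes a) _ = a

∀G? : {P : G → Set} → Decidable P → Dec (∀ g → P g)
∀G? P? = map′ (λ f (a , b , c , d , e) → f a b c d e) (λ f a b c d e → f (a , b , c , d , e))
  (all? λ a → all? λ b → all? λ c → all? λ d → all? λ e → P? (a , b , c , d , e))

fromClosedList : (L : List G) → 0G ∈ L → (∀ {x y} → x ∈ L → y ∈ L → x +G y ∈ L) → Subgroup
fromClosedList L 0∈L closed = record
  { mem      = λ g → does (g ∈? L)
  ; has-0    = dec-true (0G ∈? L) 0∈L
  ; +-closed = λ x y x∈L y∈L →
      dec-true (x +G y ∈? L) (closed (does≡true⇒ (x ∈? L) x∈L) (does≡true⇒ (y ∈? L) y∈L))
  }

-- G has exponent 6, so the first six multiples of g already form the cyclic subgroup ⟨ g ⟩.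
multiples : G → List G
multiples g = iterate (g +G_) 0G 6

AdditivelyClosed : List G → Set
AdditivelyClosed L = All (λ x → All (λ y → x +G y ∈ L) L) L

additivelyClosed? : Decidable AdditivelyClosed
additivelyClosed? L = All.all? (λ x → All.all? (λ y → x +G y ∈? L) L) L

multiples-additivelyClosed : ∀ g → AdditivelyClosed (multiples g)
multiples-additivelyClosed = from-yes (∀G? (λ g → additivelyClosed? (multiples g)))

⟨_⟩ : G → Subgroup
⟨ g ⟩ = fromClosedList (multiples g) (here refl)
  (λ x∈ y∈ → All.lookup (All.lookup (multiples-additivelyClosed g) x∈) y∈)

trivialIntersection? : ∀ S S′ → Dec (TrivialIntersection S S′)
trivialIntersection? S S′ =
  ∀G? λ g → (mem S g ≟ᵇ true) →-dec (mem S′ g ≟ᵇ true) →-dec (g ≟G 0G)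

partialSpread? : ∀ Σs → Dec (PartialSpread Σs)
partialSpread? = allPairs? trivialIntersection?

hasType? : ∀ Σs τ → Dec (HasType Σs τ)
hasType? Σs τ =
  All.all? (λ S → any? (λ p → order S ≟ℕ proj₁ p) τ) Σs
  ×-dec All.all? (λ p → countOrder (proj₁ p) Σs ≟ℕ proj₂ p) τ

isDifferenceFamily? : ∀ Σs 𝒯 → Dec (IsDifferenceFamily Σs 𝒯)
isDifferenceFamily? Σs 𝒯 = ∀G? λ g → count g (Δ𝒯 𝒯) ≟ℕ outside Σs g

spread : List Subgroup
spread = map ⟨_⟩
  ( (# 0 , # 0 , # 1 , # 0 , # 0) ∷ (# 0 , # 1 , # 0 , # 0 , # 0) ∷ (# 0 , # 1 , # 1 , # 0 , # 0)
  ∷ (# 1 , # 0 , # 0 , # 0 , # 0) ∷ (# 1 , # 0 , # 1 , # 0 , # 0) ∷ (# 1 , # 1 , # 0 , # 0 , # 0)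
  ∷ (# 1 , # 1 , # 1 , # 0 , # 0)
  ∷ (# 0 , # 0 , # 0 , # 1 , # 0) ∷ (# 0 , # 0 , # 0 , # 0 , # 1) ∷ [])

baseTriples : List Triple
baseTriples =
    triple 0G (# 0 , # 0 , # 0 , # 1 , # 2) (# 1 , # 0 , # 0 , # 1 , # 0) (λ ()) (λ ()) (λ ())
  ∷ triple 0G (# 0 , # 1 , # 1 , # 1 , # 1) (# 1 , # 1 , # 0 , # 0 , # 1) (λ ()) (λ ()) (λ ())
  ∷ triple 0G (# 1 , # 1 , # 1 , # 1 , # 1) (# 1 , # 1 , # 0 , # 1 , # 0) (λ ()) (λ ()) (λ ())
  ∷ triple 0G (# 0 , # 1 , # 0 , # 1 , # 1) (# 1 , # 1 , # 1 , # 1 , # 0) (λ ()) (λ ()) (λ ())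
  ∷ triple 0G (# 1 , # 0 , # 1 , # 2 , # 1) (# 0 , # 1 , # 1 , # 1 , # 0) (λ ()) (λ ()) (λ ())
  ∷ triple 0G (# 1 , # 0 , # 0 , # 2 , # 1) (# 1 , # 1 , # 1 , # 1 , # 2) (λ ()) (λ ()) (λ ())
  ∷ triple 0G (# 0 , # 0 , # 1 , # 1 , # 2) (# 0 , # 1 , # 1 , # 0 , # 2) (λ ()) (λ ()) (λ ())
  ∷ triple 0G (# 0 , # 0 , # 0 , # 2 , # 2) (# 0 , # 1 , # 0 , # 2 , # 1) (λ ()) (λ ()) (λ ())
  ∷ triple 0G (# 1 , # 0 , # 1 , # 1 , # 1) (# 1 , # 0 , # 0 , # 2 , # 2) (λ ()) (λ ()) (λ ())
  ∷ triple 0G (# 1 , # 1 , # 0 , # 1 , # 2) (# 0 , # 0 , # 1 , # 1 , # 0) (λ ()) (λ ()) (λ ())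
  ∷ []

lemma3p12 : HasDifferenceFamilyOfType ((2 , 7) ∷ (3 , 2) ∷ [])
lemma3p12 =
  spread ,
  from-yes (partialSpread? spread) ,
  from-yes (hasType? spread ((2 , 7) ∷ (3 , 2) ∷ [])) ,
  baseTriples ,
  from-yes (isDifferenceFamily? spread baseTriples)
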